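{- Let $u$ be a primitive word over $V$. Then $u$ is a non-ins-robust primitive word (i.e. $u \in Q_{\overline{I}}$) if and only if the word $uu$ has a factor of length $|u|$ that has a period $p$ with $p$ dividing $|u| + 1$ and $p \le |u|$.
   Context: $V$ is a finite alphabet with at least two distinct letters; $V^*$ is the set of all finite words over $V$, $|w|$ is the length of $w$. A factor of a word $w$ is a word $y$ with $w = xyz$ for some $x, z \in V^*$. A word $a_1 a_2 \cdots a_n$ ($a_i \in V$) has period $p$ (a positive integer) if $a_i = a_{i+p}$ for all $1 \le i \le n - p$. A nonempty word $w$ is primitive if it is not of the form $v^n$ for a word $v$ and an integer $n \ge 2$; $Q$ is the set of primitive words. For a word $w$ of length $n$, $w[1..i]$ denotes its prefix of length $i$ and $w[i+1..n]$ its suffix of length $n-i$. A primitive word $w$ of length $n$ is ins-robust if for every $i \in \{0,\ldots,n\}$ and every $a \in V$ the word $w[1..i]\,a\,w[i+1..n]$ is primitive; $Q_I$ is the set of ins-robust primitive words and $Q_{\overline{I}} = Q \setminus Q_I$. -}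

module Defs where

open import Data.Nat using (ℕ; suc; _+_; _≤_; _≥_)
open import Data.List using (List; []; _∷_; _++_; length; take; drop; concat; replicate; lookup)
open import Data.Fin using (Fin; toℕ)
open import Data.Product using (Σ; ∃; _×_)
open import Relation.Binary.PropositionalEquality using (_≡_; _≢_)
open import Relation.Nullary using (¬_)

module Words {V : Set} where

  Word : Set
  Word = List V

  _^ʷ_ : Word → ℕ → Word
  v ^ʷ n = concat (replicate n v)

  Factor : Word → Word → Set
  Factor y w = ∃ λ x → ∃ λ z → w ≡ x ++ y ++ z

  HasPeriod : ℕ → Word → Set
  HasPeriod p w = (1 ≤ p) × ((i j : Fin (length w)) → toℕ j ≡ toℕ i + p → lookup w i ≡ lookup w j)

  Primitive : Word → Set
  Primitive w = (w ≢ []) × ¬ (∃ λ v → ∃ λ n → (n ≥ 2) × (w ≡ v ^ʷ n))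

  insertAt : ℕ → V → Word → Word
  insertAt i a w = take i w ++ a ∷ drop i w

  InsRobust : Word → Set
  InsRobust w = Primitive w × ((i : ℕ) → i ≤ length w → (a : V) → Primitive (insertAt i a w))

  NonInsRobustPrimitive : Word → Set
  NonInsRobustPrimitive w = Primitive w × ¬ InsRobust w

-- Inserting a letter a into u = x z gives x a z, which is a proper power iff its conjugate
-- a z x is, and the words z x are exactly the factors of length |u| of u u. A word a y is a
-- proper power v ^ m (m ≥ 2) iff y has a period p ≤ |y| with p ∣ |y| + 1: take p = |v|, and
-- conversely extend y on the left by its letter y[p − 1], which keeps the period p, so that
-- the result, of length a multiple of p, is a power of its prefix of length p.
-- Since being a proper power is decidable, a non-ins-robust word has an explicit such insertion.
module Submission where

open import Defs
open import Data.Nat using (ℕ; zero; suc; _+_; _*_; _∸_; _≤_; _<_; _≥_; z≤n; s≤s; _≤?_)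
open import Data.Nat.Properties
open import Data.Nat.Divisibility using (_∣_; divides)
open import Data.Fin as Fin using (Fin; toℕ; fromℕ<)
open import Data.Fin.Properties using (any?; toℕ-fromℕ<; toℕ<n) renaming (_≟_ to _≟ᶠ_)
open import Data.List using (List; []; _∷_; _++_; _∷ʳ_; [_]; length; lookup; take; drop)
open import Data.List.Properties
  using (≡-dec; length-++; length-++-comm; length-++-≤ˡ; length-take; length-drop;
         take++drop≡id; ++-assoc; ++-identityʳ; ++-conicalʳ; ∷-injective)
open import Data.Maybe using (Maybe; just; nothing)
open import Data.Maybe.Properties using (just-injective)
open import Data.Product using (∃; _×_; _,_; proj₁; proj₂)
open import Data.Empty using (⊥-elim)
open import Relation.Nullary using (¬_; Dec; yes; contradiction)
open import Relation.Nullary.Decidable using (_×-dec_; map′; decidable-stable)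
open import Relation.Binary.Definitions using (DecidableEquality)
open import Relation.Binary.PropositionalEquality
  using (_≡_; refl; sym; trans; cong; cong₂; subst; subst₂; module ≡-Reasoning)
open ≡-Reasoning
open import Function.Bundles using (_⇔_; mk⇔)

module _ {A : Set} where
  open Words {A}

  at : List A → ℕ → Maybe A
  at []       _       = nothing
  at (x ∷ xs) zero    = just x
  at (x ∷ xs) (suc i) = at xs i

  at-just⇒< : ∀ xs {i c} → at xs i ≡ just c → i < length xs
  at-just⇒< (x ∷ xs) {zero}  _ = s≤s z≤n
  at-just⇒< (x ∷ xs) {suc i} e = s≤s (at-just⇒< xs e)

  at-<⇒just : ∀ xs {i} → i < length xs → ∃ λ c → at xs i ≡ just c
  at-<⇒just (x ∷ xs) {zero}  _         = x , refl
  at-<⇒just (x ∷ xs) {suc i} (s≤s i<n) = at-<⇒just xs i<n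

  at-++-< : ∀ xs ys {i} → i < length xs → at (xs ++ ys) i ≡ at xs i
  at-++-< (x ∷ xs) ys {zero}  _         = refl
  at-++-< (x ∷ xs) ys {suc i} (s≤s i<n) = at-++-< xs ys i<n

  at-++ˡ : ∀ xs ys {i c} → at xs i ≡ just c → at (xs ++ ys) i ≡ just c
  at-++ˡ xs ys e = trans (at-++-< xs ys (at-just⇒< xs e)) e

  at-++ʳ : ∀ xs ys i → at (xs ++ ys) (length xs + i) ≡ at ys i
  at-++ʳ []       ys i = refl
  at-++ʳ (x ∷ xs) ys i = at-++ʳ xs ys i

  at-lookup : ∀ xs (i : Fin (length xs)) → at xs (toℕ i) ≡ just (lookup xs i)
  at-lookup (x ∷ xs) Fin.zero    = refl
  at-lookup (x ∷ xs) (Fin.suc i) = at-lookup xs i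

  at-ext : ∀ xs ys → length xs ≡ length ys →
           (∀ i c → at ys i ≡ just c → at xs i ≡ just c) → xs ≡ ys
  at-ext []       []       _ _ = refl
  at-ext (x ∷ xs) (y ∷ ys) e f =
    cong₂ _∷_ (just-injective (f zero y refl)) (at-ext xs ys (suc-injective e) (λ i → f (suc i)))

  Periodic : ℕ → List A → Set
  Periodic p w = ∀ i c → at w (i + p) ≡ just c → at w i ≡ just c

  hasPeriod⇒periodic : ∀ {p w} → HasPeriod p w → Periodic p w
  hasPeriod⇒periodic {p} {w} (_ , period) i c e = begin
    at w i                 ≡⟨ cong (at w) (sym (toℕ-fromℕ< i<n)) ⟩
    at w (toℕ I)           ≡⟨ at-lookup w I ⟩
    just (lookup w I)      ≡⟨ cong just (period I J J≡I+p) ⟩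
    just (lookup w J)      ≡⟨ sym (at-lookup w J) ⟩
    at w (toℕ J)           ≡⟨ cong (at w) (toℕ-fromℕ< i+p<n) ⟩
    at w (i + p)           ≡⟨ e ⟩
    just c                 ∎
    where
    i+p<n : i + p < length w
    i+p<n = at-just⇒< w e
    i<n : i < length w
    i<n = ≤-<-trans (m≤m+n i p) i+p<n
    I = fromℕ< i<n
    J = fromℕ< i+p<n
    J≡I+p : toℕ J ≡ toℕ I + p
    J≡I+p = trans (toℕ-fromℕ< i+p<n) (cong (_+ p) (sym (toℕ-fromℕ< i<n)))

  periodic⇒hasPeriod : ∀ {p w} → 1 ≤ p → Periodic p w → HasPeriod p w
  periodic⇒hasPeriod {p} {w} 1≤p periodic = 1≤p , λ i j j≡i+p →
    just-injective (begin
      just (lookup w i)  ≡⟨ sym (at-lookup w i) ⟩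
      at w (toℕ i)       ≡⟨ periodic (toℕ i) _ (trans (cong (at w) (sym j≡i+p)) (at-lookup w j)) ⟩
      just (lookup w j)  ∎)

  periodic-++ʳ : ∀ v {p w} → Periodic p (v ++ w) → Periodic p w
  periodic-++ʳ []      periodic = periodic
  periodic-++ʳ (x ∷ v) periodic = periodic-++ʳ v (λ i → periodic (suc i))

  periodic-∷ : ∀ {q y c} → at y q ≡ just c → Periodic (suc q) y → Periodic (suc q) (c ∷ y)
  periodic-∷ y[q]≡c periodic zero    d e = trans (sym y[q]≡c) e
  periodic-∷ y[q]≡c periodic (suc i) d e = periodic i d e

  periodic-block : ∀ {p} v v′ {w} → length v ≡ p → length v′ ≡ p →
                   Periodic p (v ++ v′ ++ w) → v ≡ v′
  periodic-block {p} v v′ {w} |v| |v′| periodic =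
    at-ext v v′ (trans |v| (sym |v′|)) λ i c v′[i]≡c →
      let i<p = subst (i <_) |v′| (at-just⇒< v′ v′[i]≡c)
          shifted : at (v ++ v′ ++ w) (i + p) ≡ just c
          shifted = begin
            at (v ++ v′ ++ w) (i + p)         ≡⟨ cong (at (v ++ v′ ++ w)) i+p≡|v|+i ⟩
            at (v ++ v′ ++ w) (length v + i)  ≡⟨ at-++ʳ v (v′ ++ w) i ⟩
            at (v′ ++ w) i                    ≡⟨ at-++ˡ v′ w v′[i]≡c ⟩
            just c                            ∎
      in trans (sym (at-++-< v (v′ ++ w) (subst (i <_) (sym |v|) i<p))) (periodic i c shifted)
    where
    i+p≡|v|+i : ∀ {i} → i + p ≡ length v + i
    i+p≡|v|+i {i} = trans (+-comm i p) (cong (_+ i) (sym |v|))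

  length-take-≤ : ∀ {n} (w : List A) → n ≤ length w → length (take n w) ≡ n
  length-take-≤ {n} w n≤|w| = trans (length-take n w) (m≤n⇒m⊓n≡m n≤|w|)

  take-length-++ : ∀ (x y : List A) → take (length x) (x ++ y) ≡ x
  take-length-++ []      y = refl
  take-length-++ (a ∷ x) y = cong (a ∷_) (take-length-++ x y)

  ++-prefix-≡ : ∀ (x y u v : List A) → x ++ y ≡ u ++ v → length x ≡ length u → x ≡ u
  ++-prefix-≡ []      y []      v _ _ = refl
  ++-prefix-≡ (a ∷ x) y (b ∷ u) v e |x|≡|u| with refl , e′ ← ∷-injective e =
    cong (a ∷_) (++-prefix-≡ x y u v e′ (suc-injective |x|≡|u|))

  ++-split : ∀ (x y u v : List A) → x ++ y ≡ u ++ v → length u ≤ length x →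
             ∃ λ t → x ≡ u ++ t × v ≡ t ++ y
  ++-split x       y []      v e _ = x , refl , sym e
  ++-split (a ∷ x) y (b ∷ u) v e (s≤s |u|≤|x|) with refl , e′ ← ∷-injective e =
    let t , x≡ut , v≡ty = ++-split x y u v e′ |u|≤|x| in t , cong (a ∷_) x≡ut , v≡ty

  []-^ʷ : ∀ m → [] ^ʷ m ≡ []
  []-^ʷ zero    = refl
  []-^ʷ (suc m) = []-^ʷ m

  length-^ʷ : ∀ v m → length (v ^ʷ m) ≡ m * length v
  length-^ʷ v zero    = refl
  length-^ʷ v (suc m) = trans (length-++ v) (cong (length v +_) (length-^ʷ v m))

  ^ʷ-sucʳ : ∀ v m → v ^ʷ suc m ≡ v ^ʷ m ++ v
  ^ʷ-sucʳ v zero    = ++-identityʳ v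
  ^ʷ-sucʳ v (suc m) = trans (cong (v ++_) (^ʷ-sucʳ v m)) (sym (++-assoc v (v ^ʷ m) v))

  ^ʷ-++-shift : ∀ x y m → (x ++ y) ^ʷ m ++ x ≡ x ++ (y ++ x) ^ʷ m
  ^ʷ-++-shift x y zero    = sym (++-identityʳ x)
  ^ʷ-++-shift x y (suc m) = begin
    ((x ++ y) ++ (x ++ y) ^ʷ m) ++ x  ≡⟨ ++-assoc (x ++ y) _ x ⟩
    (x ++ y) ++ (x ++ y) ^ʷ m ++ x    ≡⟨ cong ((x ++ y) ++_) (^ʷ-++-shift x y m) ⟩
    (x ++ y) ++ x ++ (y ++ x) ^ʷ m    ≡⟨ ++-assoc x y _ ⟩
    x ++ y ++ x ++ (y ++ x) ^ʷ m      ≡⟨ cong (x ++_) (sym (++-assoc y x _)) ⟩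
    x ++ (y ++ x) ++ (y ++ x) ^ʷ m    ∎

  periodic-^ʷ : ∀ v m → Periodic (length v) (v ^ʷ m)
  periodic-^ʷ v zero    i c ()
  periodic-^ʷ v (suc m) i c e =
    subst (λ w → at w i ≡ just c) (sym (^ʷ-sucʳ v m)) (at-++ˡ (v ^ʷ m) v (begin
      at (v ^ʷ m) i                    ≡⟨ sym (at-++ʳ v (v ^ʷ m) i) ⟩
      at (v ++ v ^ʷ m) (length v + i)  ≡⟨ cong (at (v ^ʷ suc m)) (+-comm (length v) i) ⟩
      at (v ++ v ^ʷ m) (i + length v)  ≡⟨ e ⟩
      just c                           ∎))

  periodic⇒^ʷ : ∀ m {p} v {w} → length v ≡ p → Periodic p (v ++ w) → length w ≡ m * p →
                v ++ w ≡ v ^ʷ suc m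
  periodic⇒^ʷ zero    v {[]} _ _ _ = refl
  periodic⇒^ʷ (suc m) {p} v {w} |v| periodic |w| = begin
    v ++ w           ≡⟨ cong (v ++_) (sym (take++drop≡id p w)) ⟩
    v ++ v′ ++ w′    ≡⟨ cong (λ b → v ++ b ++ w′) (sym v≡v′) ⟩
    v ++ v ++ w′     ≡⟨ cong (v ++_) (periodic⇒^ʷ m v |v| periodic′ |w′|) ⟩
    v ++ v ^ʷ suc m  ∎
    where
    v′ = take p w
    w′ = drop p w
    periodic-split : Periodic p (v ++ v′ ++ w′)
    periodic-split = subst (λ b → Periodic p (v ++ b)) (sym (take++drop≡id p w)) periodic
    v≡v′ : v ≡ v′
    v≡v′ = periodic-block v v′ |v| (length-take-≤ w (subst (p ≤_) (sym |w|) (m≤m+n p (m * p))))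
                          periodic-split
    periodic′ : Periodic p (v ++ w′)
    periodic′ = subst (λ b → Periodic p (b ++ w′)) (sym v≡v′) (periodic-++ʳ v periodic-split)
    |w′| : length w′ ≡ m * p
    |w′| = trans (length-drop p w) (trans (cong (_∸ p) |w|) (m+n∸m≡n p (m * p)))

  IsProperPower : List A → Set
  IsProperPower w = ∃ λ v → ∃ λ n → (n ≥ 2) × (w ≡ v ^ʷ n)

  rotate₁ : List A → List A
  rotate₁ []       = []
  rotate₁ (x ∷ xs) = xs ∷ʳ x

  rotate : ℕ → List A → List A
  rotate zero    w = w
  rotate (suc n) w = rotate n (rotate₁ w)

  rotate-++ : ∀ x z → rotate (length x) (x ++ z) ≡ z ++ x
  rotate-++ []      z = sym (++-identityʳ z)
  rotate-++ (a ∷ x) z = begin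
    rotate (length x) ((x ++ z) ∷ʳ a)  ≡⟨ cong (rotate (length x)) (++-assoc x z [ a ]) ⟩
    rotate (length x) (x ++ z ∷ʳ a)    ≡⟨ rotate-++ x (z ∷ʳ a) ⟩
    (z ∷ʳ a) ++ x                      ≡⟨ ++-assoc z [ a ] x ⟩
    z ++ a ∷ x                         ∎

  rotate₁-^ʷ : ∀ v m → rotate₁ (v ^ʷ m) ≡ rotate₁ v ^ʷ m
  rotate₁-^ʷ []      m       = trans (cong rotate₁ ([]-^ʷ m)) (sym ([]-^ʷ m))
  rotate₁-^ʷ (a ∷ s) zero    = refl
  rotate₁-^ʷ (a ∷ s) (suc m) = begin
    (s ++ (a ∷ s) ^ʷ m) ∷ʳ a     ≡⟨ ++-assoc s _ [ a ] ⟩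
    s ++ (a ∷ s) ^ʷ m ∷ʳ a       ≡⟨ cong (s ++_) (^ʷ-++-shift [ a ] s m) ⟩
    s ++ a ∷ (s ∷ʳ a) ^ʷ m       ≡⟨ sym (++-assoc s [ a ] _) ⟩
    (s ∷ʳ a) ++ (s ∷ʳ a) ^ʷ m    ∎

  rotate-^ʷ : ∀ n v m → rotate n (v ^ʷ m) ≡ rotate n v ^ʷ m
  rotate-^ʷ zero    v m = refl
  rotate-^ʷ (suc n) v m = trans (cong (rotate n) (rotate₁-^ʷ v m)) (rotate-^ʷ n (rotate₁ v) m)

  isProperPower-conjugate : ∀ x z → IsProperPower (x ++ z) → IsProperPower (z ++ x)
  isProperPower-conjugate x z (v , m , 2≤m , x++z≡vᵐ) = rotate (length x) v , m , 2≤m , (begin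
    z ++ x                        ≡⟨ sym (rotate-++ x z) ⟩
    rotate (length x) (x ++ z)    ≡⟨ cong (rotate (length x)) x++z≡vᵐ ⟩
    rotate (length x) (v ^ʷ m)    ≡⟨ rotate-^ʷ (length x) v m ⟩
    rotate (length x) v ^ʷ m      ∎)

  ProperPeriod : List A → ℕ → Set
  ProperPeriod y n = ∃ λ p → HasPeriod p y × (p ∣ suc n) × (p ≤ n)

  properPower-∷⇒properPeriod : ∀ c y → IsProperPower (c ∷ y) → ProperPeriod y (length y)
  properPower-∷⇒properPeriod c y ([] , m , _ , e) = contradiction (trans e ([]-^ʷ m)) λ ()
  properPower-∷⇒properPeriod c y (v@(_ ∷ _) , m , 2≤m , e) =
    length v , periodic⇒hasPeriod {w = y} (s≤s z≤n) (periodic-++ʳ [ c ] {w = y} periodic) ,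
    divides m |c∷y| , |v|≤|y|
    where
    periodic : Periodic (length v) (c ∷ y)
    periodic = subst (Periodic (length v)) (sym e) (periodic-^ʷ v m)
    |c∷y| : suc (length y) ≡ m * length v
    |c∷y| = trans (cong length e) (length-^ʷ v m)
    |v|≤|y| : length v ≤ length y
    |v|≤|y| = ≤-pred (subst (length v <_) (trans (*-comm (length v) m) (sym |c∷y|))
                            (m<m*n (length v) m 2≤m))

  properPeriod⇒properPower-∷ : ∀ y → ProperPeriod y (length y) → ∃ λ c → IsProperPower (c ∷ y)
  properPeriod⇒properPower-∷ y (zero , (() , _) , _)
  properPeriod⇒properPower-∷ y (suc q , _ , divides zero () , _)
  properPeriod⇒properPower-∷ y (suc q , _ , divides 1 |c∷y| , p≤|y|) =
    ⊥-elim (<-irrefl refl (≤-trans (s≤s p≤|y|) (≤-reflexive (trans |c∷y| (+-identityʳ (suc q))))))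
  properPeriod⇒properPower-∷ y (p@(suc q) , period , divides (suc (suc m)) |c∷y| , p≤|y|) =
    c , v , suc (suc m) , s≤s (s≤s z≤n) , (begin
      c ∷ y             ≡⟨ sym (take++drop≡id p (c ∷ y)) ⟩
      v ++ w            ≡⟨ periodic⇒^ʷ (suc m) v |v| periodic-split |w| ⟩
      v ^ʷ suc (suc m)  ∎)
    where
    y[q] = at-<⇒just y p≤|y|
    c = proj₁ y[q]
    v = take p (c ∷ y)
    w = drop p (c ∷ y)
    |v| : length v ≡ p
    |v| = length-take-≤ (c ∷ y) (s≤s (≤-trans (n≤1+n q) p≤|y|))
    periodic-split : Periodic p (v ++ w)
    periodic-split = subst (Periodic p) (sym (take++drop≡id p (c ∷ y)))
                           (periodic-∷ (proj₂ y[q]) (hasPeriod⇒periodic {w = y} period))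
    |w| : length w ≡ suc m * p
    |w| = trans (length-drop p (c ∷ y)) (trans (cong (_∸ p) |c∷y|) (m+n∸m≡n p (suc m * p)))

  conjugate-factor : ∀ x z → Factor (z ++ x) ((x ++ z) ++ (x ++ z))
  conjugate-factor x z = x , z , (begin
    (x ++ z) ++ (x ++ z)  ≡⟨ ++-assoc x z (x ++ z) ⟩
    x ++ z ++ x ++ z      ≡⟨ cong (x ++_) (sym (++-assoc z x z)) ⟩
    x ++ (z ++ x) ++ z    ∎)

  factor-of-square : ∀ u x y z → u ++ u ≡ x ++ y ++ z → length y ≡ length u →
                     ∃ λ t → u ≡ x ++ t × y ≡ t ++ x
  factor-of-square u x y z uu≡xyz |y|≡|u| = conjugate (++-split u u x (y ++ z) uu≡xyz |x|≤|u|)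
    where
    conjugate : (∃ λ t → u ≡ x ++ t × y ++ z ≡ t ++ u) → ∃ λ t → u ≡ x ++ t × y ≡ t ++ x
    conjugate (t , u≡xt , yz≡tu) = t , u≡xt , ++-prefix-≡ y z (t ++ x) t
      (trans yz≡tu (trans (cong (t ++_) u≡xt) (sym (++-assoc t x t))))
      (trans |y|≡|u| (trans (cong length u≡xt) (length-++-comm x t)))
    |x|≤|u| : length x ≤ length u
    |x|≤|u| = +-cancelʳ-≤ (length u) (length x) (length u)
      (subst (_≤ length u + length u) (cong (length x +_) |y|≡|u|)
        (≤-trans (+-monoʳ-≤ (length x) (m≤m+n (length y) (length z))) (≤-reflexive lengths)))
      where
      lengths : length x + (length y + length z) ≡ length u + length u
      lengths = begin
        length x + (length y + length z)  ≡⟨ cong (length x +_) (sym (length-++ y)) ⟩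
        length x + length (y ++ z)        ≡⟨ sym (length-++ x) ⟩
        length (x ++ y ++ z)              ≡⟨ cong length (sym uu≡xyz) ⟩
        length (u ++ u)                   ≡⟨ length-++ u ⟩
        length u + length u               ∎

  insertAt-length-++ : ∀ x t (a : A) → insertAt (length x) a (x ++ t) ≡ x ++ a ∷ t
  insertAt-length-++ []      t a = refl
  insertAt-length-++ (b ∷ x) t a = cong (b ∷_) (insertAt-length-++ x t a)

  ProperPowerInsertion : List A → Set
  ProperPowerInsertion u = ∃ λ i → i ≤ length u × ∃ λ a → IsProperPower (insertAt i a u)

  PeriodicFactor : List A → Set
  PeriodicFactor u = ∃ λ y → Factor y (u ++ u) × (length y ≡ length u) × ProperPeriod y (length u)

  properPowerInsertion⇒periodicFactor : ∀ u → ProperPowerInsertion u → PeriodicFactor u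
  properPowerInsertion⇒periodicFactor u (i , _ , a , properPower) =
    y , subst (λ w → Factor y (w ++ w)) u≡xz (conjugate-factor x z) , |y|≡|u| ,
    subst (ProperPeriod y) |y|≡|u|
          (properPower-∷⇒properPeriod a y (isProperPower-conjugate x (a ∷ z) properPower))
    where
    x = take i u
    z = drop i u
    y = z ++ x
    u≡xz : x ++ z ≡ u
    u≡xz = take++drop≡id i u
    |y|≡|u| : length y ≡ length u
    |y|≡|u| = trans (length-++-comm z x) (cong length u≡xz)

  periodicFactor⇒properPowerInsertion : ∀ u → PeriodicFactor u → ProperPowerInsertion u
  periodicFactor⇒properPowerInsertion u (y , (x , z , uu≡xyz) , |y|≡|u| , period)
    with t , refl , refl ← factor-of-square u x y z uu≡xyz |y|≡|u|
    with c , properPower ← properPeriod⇒properPower-∷ (t ++ x)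
                             (subst (ProperPeriod (t ++ x)) (sym |y|≡|u|) period)
    = length x , length-++-≤ˡ x , c ,
      subst IsProperPower (sym (insertAt-length-++ x t c))
            (isProperPower-conjugate (c ∷ t) x properPower)

  properPowerInsertion⇒¬insRobust : ∀ {u} → ProperPowerInsertion u → ¬ InsRobust u
  properPowerInsertion⇒¬insRobust (i , i≤n , a , properPower) (_ , robust) =
    proj₂ (robust i i≤n a) properPower

  module _ (_≟_ : DecidableEquality A) where

    isProperPower? : ∀ w → Dec (IsProperPower w)
    isProperPower? []        = yes ([] , 2 , s≤s (s≤s z≤n) , refl)
    isProperPower? w@(_ ∷ _) = map′ unbound bound
      (any? λ d → any? λ m → (2 ≤? toℕ m) ×-dec ≡-dec _≟_ w (take (toℕ d) w ^ʷ toℕ m))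
      where
      Bounded = ∃ λ (d : Fin (suc (length w))) → ∃ λ (m : Fin (suc (length w))) →
        (2 ≤ toℕ m) × (w ≡ take (toℕ d) w ^ʷ toℕ m)
      unbound : Bounded → IsProperPower w
      unbound (d , m , 2≤m , e) = take (toℕ d) w , toℕ m , 2≤m , e
      bound : IsProperPower w → Bounded
      bound ([] , m , _ , e) = contradiction (trans e ([]-^ʷ m)) λ ()
      bound (v@(_ ∷ _) , m@(suc m′) , 2≤m , e) =
        fromℕ< |v|<n , fromℕ< m<n , subst (2 ≤_) (sym (toℕ-fromℕ< m<n)) 2≤m ,
        subst₂ (λ d k → w ≡ take d w ^ʷ k) (sym (toℕ-fromℕ< |v|<n)) (sym (toℕ-fromℕ< m<n))
               (trans e (cong (_^ʷ m) (sym take≡v)))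
        where
        |w| : length w ≡ m * length v
        |w| = trans (cong length e) (length-^ʷ v m)
        |v|<n : length v < suc (length w)
        |v|<n = s≤s (subst (length v ≤_) (sym |w|) (m≤n*m (length v) m))
        m<n : m < suc (length w)
        m<n = s≤s (subst (m ≤_) (sym |w|) (m≤m*n m (length v)))
        take≡v : take (length v) w ≡ v
        take≡v = trans (cong (take (length v)) e) (take-length-++ v (v ^ʷ m′))

module _ {k : ℕ} where
  open Words {Fin k}

  properPowerInsertion? : ∀ u → Dec (ProperPowerInsertion u)
  properPowerInsertion? u = map′
    (λ (i , a , properPower) → toℕ i , ≤-pred (toℕ<n i) , a , properPower)
    (λ (i , i≤n , a , properPower) → fromℕ< (s≤s i≤n) , a ,
       subst (λ j → IsProperPower (insertAt j a u)) (sym (toℕ-fromℕ< (s≤s i≤n))) properPower)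
    (any? λ i → any? λ a → isProperPower? _≟ᶠ_ (insertAt (toℕ i) a u))

  nonInsRobust⇒properPowerInsertion : ∀ {u} → Primitive u → ¬ InsRobust u → ProperPowerInsertion u
  nonInsRobust⇒properPowerInsertion {u} prim ¬robust =
    decidable-stable (properPowerInsertion? u) λ ¬insertion →
      ¬robust (prim , λ i i≤n a →
        (λ e → contradiction (++-conicalʳ (take i u) _ e) λ ()) ,
        (λ properPower → ¬insertion (i , i≤n , a , properPower)))

-- The equivalence holds over every finite alphabet.
theorem25 : (k : ℕ) → k ≥ 2 →
    (u : List (Fin k)) → Words.Primitive u →
    Words.NonInsRobustPrimitive u ⇔
      (∃ λ y → Words.Factor y (u ++ u) × (length y ≡ length u) ×
        (∃ λ p → Words.HasPeriod p y × (p ∣ suc (length u)) × (p ≤ length u)))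
theorem25 k _ u prim = mk⇔
  (λ (_ , ¬robust) →
     properPowerInsertion⇒periodicFactor u (nonInsRobust⇒properPowerInsertion prim ¬robust))
  (λ periodicFactor →
     prim , properPowerInsertion⇒¬insRobust (periodicFactor⇒properPowerInsertion u periodicFactor))
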